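{- Let $G_0,G_1,\dots,G_m$ be a chain decomposition of a graph $G$ rooted at $r$, and suppose $e\in E(G_i)$ is a loop. Then $G_0,\dots,G_{i-1},G_{i+1},\dots,G_m$ is a chain decomposition of $G-e$ rooted at $r$. Further, if $G$ has no isolated vertices, then $G-e$ has no isolated vertices.
   Context: Graphs are multigraphs (parallel edges and loops allowed; a loop adds $2$ to the degree; a loop is a cycle of length one and two parallel edges form a cycle of length two). Paths and cycles are simple. The degree of a vertex in a subgraph not containing it is $0$. An up chain of $G$ with respect to a pair of edge-disjoint subgraphs $(H,\overline{H})$ is a subgraph of $G$, edge-disjoint from $H$ and $\overline{H}$, which is either (i) a path with at least one edge such that every vertex is either $r$ or has degree at least two in $\overline{H}$, and each end is either $r$ or lies in $H$; or (ii) a cycle such that every vertex is either $r$ or has degree at least two in $\overline{H}$, and some vertex $v$ of it is either $r$ or has degree at least two in $H$ ($v$ is regarded as both ends, all other vertices internal). A down chain with respect to $(H,\overline{H})$ is an up chain with respect to $(\overline{H},H)$. A one-way chain with respect to $(H,\overline{H})$ is the subgraph induced by a single edge $e\notin E(H)\cup E(\overline{H})$ with ends $u$ (tail) and $v$ (head) such that $u$ is $r$ or has degree at least two in $H$, and $v$ is $r$ or has degree at least two in $\overline{H}$. A sequence $G_0,\dots,G_m$ of subgraphs of $G$ is a chain decomposition of $G$ rooted at $r\in V(G)$ if, writing $H_i=G_0\cup\cdots\cup G_{i-1}$ and $\overline{H_i}=G_{i+1}\cup\cdots\cup G_m$ (so $H_0$ and $\overline{H_m}$ are null), the sets $E(G_0),\dots,E(G_m)$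 partition $E(G)$ and each $G_i$ is an up chain, a down chain, or a one-way chain with respect to $(H_i,\overline{H_i})$. -}

module Defs where

open import Data.Nat using (ℕ; zero; suc; _+_; _≤_; _<_)
open import Data.Nat.Base using (_<ᵇ_)
open import Data.Bool using (Bool; true; false; if_then_else_; _∧_; _∨_; not)
open import Data.Fin using (Fin; toℕ; inject₁; punchIn) renaming (zero to fz; suc to fs)
open import Data.Fin.Properties using (_≟_)
open import Data.List using (List; allFin; map)
open import Data.Nat.ListAction using (sum)
open import Data.Bool.ListAction using (any)
open import Data.Product using (Σ; ∃; ∃-syntax; _×_; _,_)
open import Data.Sum using (_⊎_)
open import Function.Definitions using (Injective)
open import Relation.Binary.PropositionalEquality using (_≡_; _≢_)
open import Relation.Nullary using (¬_)
open import Relation.Nullary.Decidable using (⌊_⌋)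

-- A finite multigraph: vertices Fin n, edges Fin k, each edge with two
-- ends (src, tgt).  A loop is an edge with src ≡ tgt.  Parallel edges are
-- distinct edge indices with the same ends.
record Multigraph : Set where
  field
    n   : ℕ
    k   : ℕ
    src : Fin k → Fin n
    tgt : Fin k → Fin n

-- A (candidate) subgraph of the ambient multigraph, given by decidable
-- vertex and edge sets.
record Sub (M : Multigraph) : Set where
  field
    V : Fin (Multigraph.n M) → Bool
    E : Fin (Multigraph.k M) → Bool
open Sub public

module _ {M : Multigraph} where
  open Multigraph M

  _∈V_ : Fin n → Sub M → Set
  v ∈V S = V S v ≡ true

  _∈E_ : Fin k → Sub M → Set
  e ∈E S = E S e ≡ true

  Joins : Fin k → Fin n → Fin n → Set
  Joins e a b = (src e ≡ a × tgt e ≡ b) ⊎ (src e ≡ b × tgt e ≡ a)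

  IsLoop : Fin k → Set
  IsLoop e = src e ≡ tgt e

  -- number of ends of e equal to v (a loop at v contributes 2)
  endCount : Fin k → Fin n → ℕ
  endCount e v = (if ⌊ src e ≟ v ⌋ then 1 else 0) + (if ⌊ tgt e ≟ v ⌋ then 1 else 0)

  -- degree of v in S (0 if v is not in S, since then no edge of S meets v)
  deg : Sub M → Fin n → ℕ
  deg S v = sum (map (λ e → if E S e then endCount e v else 0) (allFin k))

  _⊑_ : Sub M → Sub M → Set
  S ⊑ T = (∀ v → v ∈V S → v ∈V T) × (∀ e → e ∈E S → e ∈E T)
        × (∀ e → e ∈E S → src e ∈V S × tgt e ∈V S)

  EdgeDisjoint : Sub M → Sub M → Set
  EdgeDisjoint S T = ∀ e → e ∈E S → ¬ (e ∈E T)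

  -- C is (exactly) a path with at least one edge, with vertex sequence
  -- ws 0 , … , ws l  (l ≥ 1 edges) and edge sequence es.
  record PathData (C : Sub M) : Set where
    field
      len    : ℕ
      ws     : Fin (suc (suc len)) → Fin n
      es     : Fin (suc len) → Fin k
      ws-inj : Injective _≡_ _≡_ ws
      es-inj : Injective _≡_ _≡_ es
      joins  : ∀ j → Joins (es j) (ws (inject₁ j)) (ws (fs j))
      V-char : ∀ v → v ∈V C → ∃[ j ] ws j ≡ v
      V-char' : ∀ j → ws j ∈V C
      E-char : ∀ e → e ∈E C → ∃[ j ] es j ≡ e
      E-char' : ∀ j → es j ∈E C

  -- C is (exactly) a cycle of length len+1 ≥ 1: closed walk
  -- ws 0 , … , ws (len+1) = ws 0, with ws 0 … ws len distinct and
  -- distinct edges es.  Length 1 is a loop, length 2 two parallel edges.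
  record CycleData (C : Sub M) : Set where
    field
      len    : ℕ
      ws     : Fin (suc (suc len)) → Fin n
      es     : Fin (suc len) → Fin k
      closed : ws fz ≡ ws (fs (Data.Fin.fromℕ len))
      ws-inj : Injective _≡_ _≡_ (λ j → ws (inject₁ j))
      es-inj : Injective _≡_ _≡_ es
      joins  : ∀ j → Joins (es j) (ws (inject₁ j)) (ws (fs j))
      V-char : ∀ v → v ∈V C → ∃[ j ] ws j ≡ v
      V-char' : ∀ j → ws j ∈V C
      E-char : ∀ e → e ∈E C → ∃[ j ] es j ≡ e
      E-char' : ∀ j → es j ∈E C

  module _ (r : Fin n) where

    RootOrDeg2 : Sub M → Fin n → Set
    RootOrDeg2 S v = v ≡ r ⊎ 2 ≤ deg S v

    UpChain : Sub M → Sub M → Sub M → Set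
    UpChain H Hb C =
      EdgeDisjoint C H × EdgeDisjoint C Hb ×
      (  (Σ (PathData C) λ P → let open PathData P in
             (∀ v → v ∈V C → RootOrDeg2 Hb v)
           × (ws fz ≡ r ⊎ ws fz ∈V H)
           × (ws (Data.Fin.fromℕ (suc len)) ≡ r ⊎ ws (Data.Fin.fromℕ (suc len)) ∈V H))
      ⊎ (CycleData C × (∀ v → v ∈V C → RootOrDeg2 Hb v)
           × (∃[ v ] v ∈V C × RootOrDeg2 H v)))

    DownChain : Sub M → Sub M → Sub M → Set
    DownChain H Hb C = UpChain Hb H C

    OneWayChain : Sub M → Sub M → Sub M → Set
    OneWayChain H Hb C = ∃[ e ]
        (∀ f → f ∈E C → f ≡ e) × e ∈E C
      × (∀ v → v ∈V C → v ≡ src e ⊎ v ≡ tgt e) × src e ∈V C × tgt e ∈V C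
      × ¬ (e ∈E H) × ¬ (e ∈E Hb)
      × (∃[ u ] ∃[ w ] Joins e u w × RootOrDeg2 H u × RootOrDeg2 Hb w)

    module _ {m : ℕ} (Gs : Fin (suc m) → Sub M) (i : Fin (suc m)) where
      Before : Sub M
      Before = record
        { V = λ v → any (λ j → (toℕ j <ᵇ toℕ i) ∧ V (Gs j) v) (allFin (suc m))
        ; E = λ e → any (λ j → (toℕ j <ᵇ toℕ i) ∧ E (Gs j) e) (allFin (suc m)) }
      After : Sub M
      After = record
        { V = λ v → any (λ j → (toℕ i <ᵇ toℕ j) ∧ V (Gs j) v) (allFin (suc m))
        ; E = λ e → any (λ j → (toℕ i <ᵇ toℕ j) ∧ E (Gs j) e) (allFin (suc m)) }

    IsChainDecomposition : (G : Sub M) {m : ℕ} → (Fin (suc m) → Sub M) → Set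
    IsChainDecomposition G {m} Gs =
        r ∈V G
      × (∀ i → Gs i ⊑ G)
      × (∀ e → e ∈E G → ∃[ i ] e ∈E Gs i)
      × (∀ i j e → e ∈E Gs i → e ∈E Gs j → i ≡ j)
      × (∀ i → UpChain (Before Gs i) (After Gs i) (Gs i)
             ⊎ DownChain (Before Gs i) (After Gs i) (Gs i)
             ⊎ OneWayChain (Before Gs i) (After Gs i) (Gs i))

  whole : Sub M
  whole = record { V = λ _ → true ; E = λ _ → true }

  _─_ : Sub M → Fin k → Sub M
  S ─ e = record { V = V S ; E = λ f → E S f ∧ not ⌊ f ≟ e ⌋ }

  NoIsolatedVertices : Sub M → Set
  NoIsolatedVertices S = ∀ v → v ∈V S → deg S v ≢ 0

-- A chain containing a loop e cannot be a path (a path repeats no vertex), and a cycle through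
-- a loop has length one; so the chain is e alone, at a vertex v that is the root or has
-- degree at least two on both sides of it.  Deleting this chain keeps every other chain valid:
-- the unions H and H̄ seen by another chain lose only e and possibly v, and wherever v was
-- needed (as an end, or with degree at least two through e) the condition of the deleted chain
-- on the same side provides other edges at v.  For the second claim, v keeps an edge in G - e:
-- either it has degree at least two before the loop chain, or it is the root, which the first
-- chain of any chain decomposition touches.
module Submission where

open import Defs
open import Data.Bool using (Bool; true; false; _∧_; not; if_then_else_)
open import Data.Bool.Properties using (T-≡; ∧-conicalˡ; ∧-conicalʳ; ∧-zeroʳ; not-¬)
open import Data.Bool.ListAction using (any)
open import Data.Empty using (⊥-elim)
open import Data.Fin using (Fin; toℕ; inject₁; fromℕ; punchIn; punchOut)
  renaming (zero to fz; suc to fs)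
open import Data.Fin.Properties
  using (_≟_; toℕ-inject₁; punchIn-injective; punchInᵢ≢i; punchIn-punchOut)
open import Data.Fin.Relation.Unary.Top using (view; ‵fromℕ; ‵inject₁)
open import Data.List using ([]; _∷_; map; allFin)
open import Data.List.Membership.Propositional using (_∈_; lose)
open import Data.List.Membership.Propositional.Properties using (∈-allFin)
open import Data.List.Relation.Unary.Any using (here; there; satisfied)
open import Data.List.Relation.Unary.Any.Properties using (any⁺; any⁻)
open import Data.Nat using (ℕ; zero; suc; _+_; _≤_; _<ᵇ_; z≤n)
open import Data.Nat.ListAction using (sum)
open import Data.Nat.Properties
  using (≤-refl; ≤-trans; +-mono-≤; m+n≡0⇒m≡0; m+n≡0⇒n≡0; m<n⇒n≢0; 1+n≢n)
  renaming (_≟_ to _≟ℕ_)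
open import Data.Product using (∃-syntax; _×_; _,_; proj₁; proj₂)
import Data.Product as Product
open import Data.Sum using (_⊎_; inj₁; inj₂; [_,_])
import Data.Sum as Sum
open import Function using (_∘_; id; Equivalence)
open import Function.Definitions using (Injective)
open import Relation.Binary.PropositionalEquality
  using (_≡_; _≢_; refl; sym; trans; cong; cong₂; subst)
open import Relation.Nullary using (¬_; yes; no)

open Equivalence using (to; from)

any-allFin⁺ : ∀ {N} (p : Fin N → Bool) j → p j ≡ true → any p (allFin N) ≡ true
any-allFin⁺ p j pj = to T-≡ (any⁺ p (lose (∈-allFin j) (from T-≡ pj)))

any-allFin⁻ : ∀ {N} (p : Fin N → Bool) → any p (allFin N) ≡ true → ∃[ j ] p j ≡ true
any-allFin⁻ p h = Product.map₂ (to T-≡) (satisfied (any⁻ p (allFin _) (from T-≡ h)))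

sum-map-mono : ∀ {A : Set} {g h : A → ℕ} → (∀ x → g x ≤ h x) →
               ∀ xs → sum (map g xs) ≤ sum (map h xs)
sum-map-mono g≤h []       = z≤n
sum-map-mono g≤h (x ∷ xs) = +-mono-≤ (g≤h x) (sum-map-mono g≤h xs)

sum-map≢0⇒∃ : ∀ {A : Set} (g : A → ℕ) xs → sum (map g xs) ≢ 0 → ∃[ x ] g x ≢ 0
sum-map≢0⇒∃ g []       s≢0 = ⊥-elim (s≢0 refl)
sum-map≢0⇒∃ g (x ∷ xs) s≢0 with g x ≟ℕ 0
... | no gx≢0  = x , gx≢0
... | yes gx≡0 = sum-map≢0⇒∃ g xs (λ s≡0 → s≢0 (cong₂ _+_ gx≡0 s≡0))

∈⇒sum-map≢0 : ∀ {A : Set} (g : A → ℕ) {x xs} → x ∈ xs → g x ≢ 0 → sum (map g xs) ≢ 0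
∈⇒sum-map≢0 g {xs = y ∷ _} (here refl) gx≢0 s≡0 = gx≢0 (m+n≡0⇒m≡0 (g y) s≡0)
∈⇒sum-map≢0 g {xs = y ∷ _} (there x∈) gx≢0 s≡0 =
  ∈⇒sum-map≢0 g x∈ gx≢0 (m+n≡0⇒n≡0 (g y) s≡0)

inject₁≢suc : ∀ {N} (j : Fin N) → inject₁ j ≢ fs j
inject₁≢suc j eq = 1+n≢n (trans (sym (cong toℕ eq)) (toℕ-inject₁ j))

closed-walk-stutter-unique : ∀ {A : Set} {l} (ws : Fin (suc (suc l)) → A) →
  ws fz ≡ ws (fs (fromℕ l)) → Injective _≡_ _≡_ (ws ∘ inject₁) →
  ∀ {j} → ws (inject₁ j) ≡ ws (fs j) → ∀ j′ → j′ ≡ j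
closed-walk-stutter-unique {l = zero}  _  _      _   {fz} _       fz = refl
closed-walk-stutter-unique {l = suc _} ws closed inj {j}  stutter _ with view j
... | ‵inject₁ i = ⊥-elim (inject₁≢suc i (inj stutter))
... | ‵fromℕ with inj {y = fz} (trans stutter (sym closed))
...   | ()

data PunchInView {N} (i : Fin (suc N)) : Fin (suc N) → Set where
  at      : PunchInView i i
  punched : ∀ j → PunchInView i (punchIn i j)

punchInView : ∀ {N} (i q : Fin (suc N)) → PunchInView i q
punchInView i q with i ≟ q
... | yes refl = at
... | no i≢q   = subst (PunchInView i) (punchIn-punchOut i≢q) (punched (punchOut i≢q))

record PunchInStableOrder : Set where
  field
    _≺_       : ∀ {N} → Fin N → Fin N → Bool
    punchIn-≺ : ∀ {N} (i : Fin (suc N)) a b → punchIn i a ≺ punchIn i b ≡ a ≺ b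
    ≺-trans   : ∀ {N} {a b c : Fin N} → a ≺ b ≡ true → b ≺ c ≡ true → a ≺ c ≡ true

<ᵇ-trans : ∀ x y z → (x <ᵇ y) ≡ true → (y <ᵇ z) ≡ true → (x <ᵇ z) ≡ true
<ᵇ-trans zero    (suc y) (suc z) _ _ = refl
<ᵇ-trans (suc x) (suc y) (suc z) p q = <ᵇ-trans x y z p q

punchIn-<ᵇ : ∀ {N} (i : Fin (suc N)) a b →
             (toℕ (punchIn i a) <ᵇ toℕ (punchIn i b)) ≡ (toℕ a <ᵇ toℕ b)
punchIn-<ᵇ fz     a      b      = refl
punchIn-<ᵇ (fs i) fz     fz     = refl
punchIn-<ᵇ (fs i) fz     (fs b) = refl
punchIn-<ᵇ (fs i) (fs a) fz     = refl
punchIn-<ᵇ (fs i) (fs a) (fs b) = punchIn-<ᵇ i a b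

-- Before r Gs p and After r Gs p are, definitionally, the unions ⋃ (_≺ p) Gs for these orders.
<-order : PunchInStableOrder
<-order = record
  { _≺_       = λ a b → toℕ a <ᵇ toℕ b
  ; punchIn-≺ = punchIn-<ᵇ
  ; ≺-trans   = λ {_} {a} {b} {c} → <ᵇ-trans (toℕ a) (toℕ b) (toℕ c) }

>-order : PunchInStableOrder
>-order = record
  { _≺_       = λ a b → toℕ b <ᵇ toℕ a
  ; punchIn-≺ = λ i a b → punchIn-<ᵇ i b a
  ; ≺-trans   = λ {_} {a} {b} {c} p q → <ᵇ-trans (toℕ c) (toℕ b) (toℕ a) q p }

module _ {M : Multigraph} where
  open Multigraph M

  Incident : Fin k → Fin n → Set
  Incident f w = src f ≡ w ⊎ tgt f ≡ w

  joins-incidentˡ : ∀ {f a b} → Joins {M} f a b → Incident f a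
  joins-incidentˡ (inj₁ (s≡a , _)) = inj₁ s≡a
  joins-incidentˡ (inj₂ (_ , t≡a)) = inj₂ t≡a

  joins-incidentʳ : ∀ {f a b} → Joins {M} f a b → Incident f b
  joins-incidentʳ (inj₁ (_ , t≡b)) = inj₂ t≡b
  joins-incidentʳ (inj₂ (s≡b , _)) = inj₁ s≡b

  joins-loop : ∀ {e a b} → IsLoop {M} e → Joins {M} e a b → a ≡ src e × b ≡ src e
  joins-loop loop (inj₁ (s≡a , t≡b)) = sym s≡a , trans (sym t≡b) (sym loop)
  joins-loop loop (inj₂ (s≡b , t≡a)) = trans (sym t≡a) (sym loop) , sym s≡b

  loop-incident : ∀ {e w} → IsLoop {M} e → Incident e w → w ≡ src e
  loop-incident loop (inj₁ s≡w) = sym s≡w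
  loop-incident loop (inj₂ t≡w) = trans (sym t≡w) (sym loop)

  walk-incident : ∀ {l} (ws : Fin (suc (suc l)) → Fin n) (es : Fin (suc l) → Fin k) →
    (∀ j → Joins {M} (es j) (ws (inject₁ j)) (ws (fs j))) →
    ∀ j → ∃[ j′ ] Incident (es j′) (ws j)
  walk-incident ws es joins fz     = fz , joins-incidentˡ (joins fz)
  walk-incident ws es joins (fs j) = j , joins-incidentʳ (joins j)

  endCount≢0⇒incident : ∀ {f w} → endCount {M} f w ≢ 0 → Incident f w
  endCount≢0⇒incident {f} {w} c≢0 with src f ≟ w | tgt f ≟ w
  ... | yes s≡w | _       = inj₁ s≡w
  ... | no _    | yes t≡w = inj₂ t≡w
  ... | no _    | no _    = ⊥-elim (c≢0 refl)

  incident⇒endCount≢0 : ∀ {f w} → Incident f w → endCount {M} f w ≢ 0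
  incident⇒endCount≢0 {f} {w} inc with src f ≟ w | tgt f ≟ w
  ... | yes _   | _       = λ ()
  ... | no _    | yes _   = λ ()
  ... | no s≢w  | no t≢w  = ⊥-elim ([ s≢w , t≢w ] inc)

  deg-mono : ∀ (S T : Sub M) {w} → (∀ {f} → f ∈E S → Incident f w → f ∈E T) →
             deg S w ≤ deg T w
  deg-mono S T {w} S⊆T = sum-map-mono term-mono (allFin k)
    where
    term-mono : ∀ f → (if E S f then endCount {M} f w else 0) ≤ (if E T f then endCount {M} f w else 0)
    term-mono f with E S f in f∈S
    ... | false = z≤n
    ... | true with endCount {M} f w ≟ℕ 0
    ...   | yes c≡0 rewrite c≡0 = z≤n
    ...   | no c≢0 rewrite S⊆T f∈S (endCount≢0⇒incident c≢0) = ≤-refl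

  deg≢0⇒incident : ∀ (S : Sub M) {w} → deg S w ≢ 0 → ∃[ f ] f ∈E S × Incident f w
  deg≢0⇒incident S {w} d≢0 with sum-map≢0⇒∃ _ (allFin k) d≢0
  ... | f , t≢0 with E S f in f∈S
  ...   | true  = f , f∈S , endCount≢0⇒incident t≢0
  ...   | false = ⊥-elim (t≢0 refl)

  incident⇒deg≢0 : ∀ {S : Sub M} {f w} → f ∈E S → Incident f w → deg S w ≢ 0
  incident⇒deg≢0 {S} {f} {w} f∈S inc =
    ∈⇒sum-map≢0 _ (∈-allFin f)
      (subst (λ b → (if b then endCount {M} f w else 0) ≢ 0) (sym f∈S) (incident⇒endCount≢0 inc))

  incident-∈V : ∀ {S T : Sub M} {f w} → S ⊑ T → f ∈E S → Incident f w → w ∈V S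
  incident-∈V (_ , _ , ends) f∈S (inj₁ refl) = proj₁ (ends _ f∈S)
  incident-∈V (_ , _ , ends) f∈S (inj₂ refl) = proj₂ (ends _ f∈S)

  ∈E-─⁺ : ∀ {S : Sub M} {f e} → f ∈E S → f ≢ e → f ∈E (S ─ e)
  ∈E-─⁺ {f = f} {e} f∈S f≢e with f ≟ e
  ... | yes f≡e = ⊥-elim (f≢e f≡e)
  ... | no _    = cong₂ _∧_ f∈S refl

  ∈E-─⁻ : ∀ {S : Sub M} {f e} → f ∈E (S ─ e) → f ∈E S × f ≢ e
  ∈E-─⁻ {S} {f} f∈ = ∧-conicalˡ _ _ f∈ , f≢e
    where
    f≢e : f ≢ _
    f≢e refl with f ≟ f
    ... | no f≢f = f≢f refl
    ... | yes _ with () ← trans (sym (∧-zeroʳ (E S f))) f∈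

  incident⇒deg-─≢0 : ∀ (S : Sub M) {f e w} → f ∈E S → f ≢ e → Incident f w →
                     deg (S ─ e) w ≢ 0
  incident⇒deg-─≢0 S f∈S f≢e = incident⇒deg≢0 {S = S ─ _} (∈E-─⁺ {S = S} f∈S f≢e)

  ⊑-─ : ∀ {S T : Sub M} {e} → S ⊑ T → ¬ (e ∈E S) → S ⊑ (T ─ e)
  ⊑-─ {T = T} (V⊆ , E⊆ , ends) e∉S =
    V⊆ , (λ f f∈S → ∈E-─⁺ {S = T} (E⊆ f f∈S) λ { refl → e∉S f∈S }) , ends

  ⋃ : ∀ {N} → (Fin N → Bool) → (Fin N → Sub M) → Sub M
  ⋃ {N} sel Gs = record
    { V = λ v → any (λ q → sel q ∧ V (Gs q) v) (allFin N)
    ; E = λ f → any (λ q → sel q ∧ E (Gs q) f) (allFin N) }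

  module _ {N} (sel : Fin N → Bool) (Gs : Fin N → Sub M) where

    ∈E-⋃⁺ : ∀ {q f} → sel q ≡ true → f ∈E Gs q → f ∈E ⋃ sel Gs
    ∈E-⋃⁺ {q} s f∈ = any-allFin⁺ _ q (cong₂ _∧_ s f∈)

    ∈V-⋃⁺ : ∀ {q w} → sel q ≡ true → w ∈V Gs q → w ∈V ⋃ sel Gs
    ∈V-⋃⁺ {q} s w∈ = any-allFin⁺ _ q (cong₂ _∧_ s w∈)

    ∈E-⋃⁻ : ∀ {f} → f ∈E ⋃ sel Gs → ∃[ q ] sel q ≡ true × f ∈E Gs q
    ∈E-⋃⁻ f∈ with any-allFin⁻ _ f∈
    ... | q , h = q , ∧-conicalˡ _ _ h , ∧-conicalʳ _ _ h

    ∈V-⋃⁻ : ∀ {w} → w ∈V ⋃ sel Gs → ∃[ q ] sel q ≡ true × w ∈V Gs q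
    ∈V-⋃⁻ w∈ with any-allFin⁻ _ w∈
    ... | q , h = q , ∧-conicalˡ _ _ h , ∧-conicalʳ _ _ h

    ∈E-⋃⇒∈E : ∀ {T : Sub M} {f} → (∀ q → Gs q ⊑ T) → f ∈E ⋃ sel Gs → f ∈E T
    ∈E-⋃⇒∈E Gs⊑ f∈ with ∈E-⋃⁻ f∈
    ... | q , _ , f∈Gq = proj₁ (proj₂ (Gs⊑ q)) _ f∈Gq

    ⋃-incident-∈V : ∀ {T : Sub M} {f w} → (∀ q → Gs q ⊑ T) →
                    f ∈E ⋃ sel Gs → Incident f w → w ∈V ⋃ sel Gs
    ⋃-incident-∈V Gs⊑ f∈ inc with ∈E-⋃⁻ f∈
    ... | q , s , f∈Gq = ∈V-⋃⁺ s (incident-∈V (Gs⊑ q) f∈Gq inc)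

  record IsLoopAt (C : Sub M) (e : Fin k) : Set where
    field
      e∈        : e ∈E C
      src∈      : src e ∈V C
      edges-≡    : ∀ f → f ∈E C → f ≡ e
      vertices-≡ : ∀ w → w ∈V C → w ≡ src e

  path-loop-free : ∀ {C : Sub M} {e} → PathData C → e ∈E C → ¬ IsLoop {M} e
  path-loop-free P e∈C loop with PathData.E-char P _ e∈C
  ... | j , refl with joins-loop loop (PathData.joins P j)
  ...   | here≡ , next≡ = inject₁≢suc j (PathData.ws-inj P (trans here≡ (sym next≡)))

  cycle-loop : ∀ {C : Sub M} {e} → CycleData C → e ∈E C → IsLoop {M} e → IsLoopAt C e
  cycle-loop {C} {e} Cy e∈C loop with CycleData.E-char Cy _ e∈C
  ... | j , refl = record
    { e∈ = e∈C
    ; src∈ = subst (_∈V C) ws≡ (V-char′ (inject₁ j))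
    ; edges-≡ = λ f f∈ → let j′ , es≡ = E-char f f∈ in trans (sym es≡) (cong es (unique j′))
    ; vertices-≡ = λ w w∈ → let j′ , ws≡w = V-char w w∈ in trans (sym ws≡w) (vertex j′) }
    where
    open CycleData Cy renaming (V-char' to V-char′)
    ws≡ : ws (inject₁ j) ≡ src e
    ws≡ = proj₁ (joins-loop loop (joins j))
    ws′≡ : ws (fs j) ≡ src e
    ws′≡ = proj₂ (joins-loop loop (joins j))
    unique : ∀ j′ → j′ ≡ j
    unique = closed-walk-stutter-unique ws closed ws-inj (trans ws≡ (sym ws′≡))
    vertex : ∀ j′ → ws j′ ≡ src e
    vertex fz      = subst (λ x → ws (inject₁ x) ≡ src e) (sym (unique fz)) ws≡
    vertex (fs j′) = subst (λ x → ws (fs x) ≡ src e) (sym (unique j′)) ws′≡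

  module _ (r : Fin n) where

    Chain : Sub M → Sub M → Sub M → Set
    Chain H Hb C = UpChain r H Hb C ⊎ DownChain r H Hb C ⊎ OneWayChain r H Hb C

    record CanReplace (H H′ : Sub M) : Set where
      field
        edges      : ∀ {f} → f ∈E H′ → f ∈E H
        rootOrDeg2 : ∀ w → RootOrDeg2 r H w → RootOrDeg2 r H′ w
        vertices   : ∀ w → w ∈V H → w ≡ r ⊎ w ∈V H′

    module _ {H H′ : Sub M} (ρ : CanReplace H H′) where
      open CanReplace ρ

      edgeDisjoint-replace : ∀ {C : Sub M} → EdgeDisjoint C H → EdgeDisjoint C H′
      edgeDisjoint-replace C#H f f∈C = C#H f f∈C ∘ edges

      end-replace : ∀ {x} → x ≡ r ⊎ x ∈V H → x ≡ r ⊎ x ∈V H′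
      end-replace = [ inj₁ , vertices _ ]

      all-rootOrDeg2-replace : ∀ {C : Sub M} → (∀ v → v ∈V C → RootOrDeg2 r H v) →
                               ∀ v → v ∈V C → RootOrDeg2 r H′ v
      all-rootOrDeg2-replace all v v∈ = rootOrDeg2 v (all v v∈)

    module _ {H H′ Hb Hb′ : Sub M} (ρ : CanReplace H H′) (ρ̄ : CanReplace Hb Hb′) where
      open CanReplace

      upChain-replace : ∀ {C : Sub M} → UpChain r H Hb C → UpChain r H′ Hb′ C
      upChain-replace {C} (C#H , C#Hb , inj₁ (P , all , first , last)) =
        edgeDisjoint-replace ρ {C} C#H , edgeDisjoint-replace ρ̄ {C} C#Hb ,
        inj₁ (P , all-rootOrDeg2-replace ρ̄ {C} all , end-replace ρ first , end-replace ρ last)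
      upChain-replace {C} (C#H , C#Hb , inj₂ (Cy , all , (v , v∈ , rd))) =
        edgeDisjoint-replace ρ {C} C#H , edgeDisjoint-replace ρ̄ {C} C#Hb ,
        inj₂ (Cy , all-rootOrDeg2-replace ρ̄ {C} all , (v , v∈ , rootOrDeg2 ρ v rd))

      oneWayChain-replace : ∀ {C : Sub M} → OneWayChain r H Hb C → OneWayChain r H′ Hb′ C
      oneWayChain-replace (e , only , e∈ , vs , s∈ , t∈ , e∉H , e∉Hb , (u , w , J , ru , rw)) =
        e , only , e∈ , vs , s∈ , t∈ , e∉H ∘ edges ρ , e∉Hb ∘ edges ρ̄ ,
        (u , w , J , rootOrDeg2 ρ u ru , rootOrDeg2 ρ̄ w rw)

    chain-replace : ∀ {H H′ Hb Hb′ C : Sub M} → CanReplace H H′ → CanReplace Hb Hb′ →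
                    Chain H Hb C → Chain H′ Hb′ C
    chain-replace ρ ρ̄ (inj₁ up)          = inj₁ (upChain-replace ρ ρ̄ up)
    chain-replace ρ ρ̄ (inj₂ (inj₁ down)) = inj₂ (inj₁ (upChain-replace ρ̄ ρ down))
    chain-replace ρ ρ̄ (inj₂ (inj₂ one))  = inj₂ (inj₂ (oneWayChain-replace ρ ρ̄ one))

    record LoopChain (H Hb C : Sub M) (e : Fin k) : Set where
      field
        isLoopAt      : IsLoopAt C e
        ∉H            : ¬ (e ∈E H)
        ∉Hb           : ¬ (e ∈E Hb)
        rootOrDeg2-H  : RootOrDeg2 r H (src e)
        rootOrDeg2-Hb : RootOrDeg2 r Hb (src e)

    LoopChain-swap : ∀ {H Hb C : Sub M} {e} → LoopChain Hb H C e → LoopChain H Hb C e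
    LoopChain-swap lc = record
      { isLoopAt = isLoopAt ; ∉H = ∉Hb ; ∉Hb = ∉H
      ; rootOrDeg2-H = rootOrDeg2-Hb ; rootOrDeg2-Hb = rootOrDeg2-H }
      where open LoopChain lc

    upChain-loop : ∀ {H Hb C : Sub M} {e} → UpChain r H Hb C → e ∈E C → IsLoop {M} e →
                   LoopChain H Hb C e
    upChain-loop (_ , _ , inj₁ (P , _)) e∈C loop = ⊥-elim (path-loop-free P e∈C loop)
    upChain-loop {H} {_} {C} {e} (C#H , C#Hb , inj₂ (Cy , all , (v , v∈ , rd))) e∈C loop = record
      { isLoopAt = C-loop
      ; ∉H = C#H _ e∈C ; ∉Hb = C#Hb _ e∈C
      ; rootOrDeg2-H = subst (RootOrDeg2 r H) (vertices-≡ v v∈) rd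
      ; rootOrDeg2-Hb = all _ src∈ }
      where
      C-loop : IsLoopAt C e
      C-loop = cycle-loop Cy e∈C loop
      open IsLoopAt C-loop

    oneWayChain-loop : ∀ {H Hb C : Sub M} {e} → OneWayChain r H Hb C → e ∈E C → IsLoop {M} e →
                       LoopChain H Hb C e
    oneWayChain-loop {H} {Hb} {_} {e}
      (_ , only , _ , vs , s∈ , _ , e∉H , e∉Hb , (u , w , J , ru , rw)) e∈C loop
      with only e e∈C
    ... | refl = record
      { isLoopAt = record
        { e∈ = e∈C ; src∈ = s∈ ; edges-≡ = only
        ; vertices-≡ = λ x x∈ → [ id , (λ x≡t → trans x≡t (sym loop)) ] (vs x x∈) }
      ; ∉H = e∉H ; ∉Hb = e∉Hb
      ; rootOrDeg2-H = subst (RootOrDeg2 r H) (proj₁ (joins-loop loop J)) ru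
      ; rootOrDeg2-Hb = subst (RootOrDeg2 r Hb) (proj₂ (joins-loop loop J)) rw }

    chain-loop : ∀ {H Hb C : Sub M} {e} → Chain H Hb C → e ∈E C → IsLoop {M} e →
                 LoopChain H Hb C e
    chain-loop (inj₁ up)          = upChain-loop up
    chain-loop (inj₂ (inj₁ down)) = λ e∈ loop → LoopChain-swap (upChain-loop down e∈ loop)
    chain-loop (inj₂ (inj₂ one))  = oneWayChain-loop one

    chain-touches-root : ∀ {H Hb C : Sub M} → (∀ f → ¬ (f ∈E H)) → (∀ w → ¬ (w ∈V H)) →
                         Chain H Hb C → ∃[ f ] f ∈E C × Incident f r
    chain-touches-root {H} {Hb} {C} edgeless vertexless = touches
      where
      rootOrDeg2⇒root : ∀ {w} → RootOrDeg2 r H w → w ≡ r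
      rootOrDeg2⇒root (inj₁ w≡r)  = w≡r
      rootOrDeg2⇒root (inj₂ 2≤d) =
        ⊥-elim (edgeless _ (proj₁ (proj₂ (deg≢0⇒incident H (m<n⇒n≢0 2≤d)))))

      end⇒root : ∀ {w} → w ≡ r ⊎ w ∈V H → w ≡ r
      end⇒root = [ id , ⊥-elim ∘ vertexless _ ]

      walk-touches : ∀ {l} (ws : Fin (suc (suc l)) → Fin n) (es : Fin (suc l) → Fin k) →
        (∀ j → Joins {M} (es j) (ws (inject₁ j)) (ws (fs j))) → (∀ j → es j ∈E C) →
        ∀ j → ws j ≡ r → ∃[ f ] f ∈E C × Incident f r
      walk-touches ws es joins es∈ j ws≡r =
        let j′ , inc = walk-incident ws es joins j
        in es j′ , es∈ j′ , subst (Incident (es j′)) ws≡r inc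

      touches : Chain H Hb C → ∃[ f ] f ∈E C × Incident f r
      touches (inj₁ (_ , _ , inj₁ (P , _ , first , _))) =
        walk-touches ws es joins E-char' fz (end⇒root first)
        where open PathData P
      touches (inj₁ (_ , _ , inj₂ (Cy , _ , (v , v∈ , rd)))) =
        let j , ws≡v = V-char v v∈
        in walk-touches ws es joins E-char' j (trans ws≡v (rootOrDeg2⇒root rd))
        where open CycleData Cy
      touches (inj₂ (inj₁ (_ , _ , inj₁ (P , all , _)))) =
        walk-touches ws es joins E-char' fz (rootOrDeg2⇒root (all _ (V-char' fz)))
        where open PathData P
      touches (inj₂ (inj₁ (_ , _ , inj₂ (Cy , all , _)))) =
        walk-touches ws es joins E-char' fz (rootOrDeg2⇒root (all _ (V-char' fz)))
        where open CycleData Cy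
      touches (inj₂ (inj₂ (f , _ , f∈ , _ , _ , _ , _ , _ , (u , _ , J , ru , _)))) =
        f , f∈ , subst (Incident f) (rootOrDeg2⇒root ru) (joins-incidentˡ J)

    root-incident : ∀ {G : Sub M} {m} {Gs : Fin (suc m) → Sub M} → IsChainDecomposition r G Gs →
                    ∃[ f ] f ∈E G × Incident f r
    root-incident {Gs = Gs} (_ , Gs⊑ , _ , _ , chains) =
      let f , f∈ , inc =
            chain-touches-root {Before r Gs fz} {After r Gs fz} edgeless vertexless (chains fz)
      in f , proj₁ (proj₂ (Gs⊑ fz)) f f∈ , inc
      where
      edgeless : ∀ f → ¬ (f ∈E ⋃ (λ q → toℕ q <ᵇ 0) Gs)
      edgeless f f∈ with ∈E-⋃⁻ (λ q → toℕ q <ᵇ 0) Gs {f} f∈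
      ... | _ , () , _
      vertexless : ∀ w → ¬ (w ∈V ⋃ (λ q → toℕ q <ᵇ 0) Gs)
      vertexless w w∈ with ∈V-⋃⁻ (λ q → toℕ q <ᵇ 0) Gs {w} w∈
      ... | _ , () , _

    module DeleteLoopChain {G : Sub M} {m} (Gs : Fin (suc (suc m)) → Sub M) (Gs⊑ : ∀ q → Gs q ⊑ G)
      (disjoint : ∀ a b f → f ∈E Gs a → f ∈E Gs b → a ≡ b)
      {i : Fin (suc (suc m))} {e : Fin k} (loop : IsLoop {M} e) (Gi-loop : IsLoopAt (Gs i) e)
      (O : PunchInStableOrder) where
      open PunchInStableOrder O
      open IsLoopAt Gi-loop

      Gs′ : Fin (suc m) → Sub M
      Gs′ = Gs ∘ punchIn i

      U : Fin (suc (suc m)) → Sub M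
      U p = ⋃ (_≺ p) Gs

      U′ : Fin (suc m) → Sub M
      U′ j = ⋃ (_≺ j) Gs′

      module _ (e∉Ui : ¬ (e ∈E U i)) (rd : RootOrDeg2 r (U i) (src e)) (j : Fin (suc m)) where
        p : Fin (suc (suc m))
        p = punchIn i j

        U′⊆U : ∀ {f} → f ∈E U′ j → f ∈E U p
        U′⊆U f∈ with ∈E-⋃⁻ (_≺ j) Gs′ f∈
        ... | q , q≺j , f∈Gq = ∈E-⋃⁺ (_≺ p) Gs (trans (punchIn-≺ i q j) q≺j) f∈Gq

        U⊆U′ : ∀ {f} → f ∈E U p → f ≢ e → f ∈E U′ j
        U⊆U′ f∈ f≢e with ∈E-⋃⁻ (_≺ p) Gs f∈
        ... | q , q≺p , f∈Gq with punchInView i q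
        ...   | at         = ⊥-elim (f≢e (edges-≡ _ f∈Gq))
        ...   | punched q′ = ∈E-⋃⁺ (_≺ j) Gs′ (trans (sym (punchIn-≺ i q′ j)) q≺p) f∈Gq

        e∈U⇒i≺p : e ∈E U p → i ≺ p ≡ true
        e∈U⇒i≺p e∈U with ∈E-⋃⁻ (_≺ p) Gs e∈U
        ... | q , q≺p , e∈Gq with disjoint q i e e∈Gq e∈
        ...   | refl = q≺p

        Ui⊆U′ : i ≺ p ≡ true → ∀ {f} → f ∈E U i → f ∈E U′ j
        Ui⊆U′ i≺p f∈ with ∈E-⋃⁻ (_≺ i) Gs f∈
        ... | q , q≺i , f∈Gq =
          U⊆U′ (∈E-⋃⁺ (_≺ p) Gs (≺-trans q≺i i≺p) f∈Gq) λ { refl → e∉Ui f∈ }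

        -- If e lies in U p then so does all of U i, which gives src e its degree away from e.
        rootOrDeg2-U′ : ∀ w → RootOrDeg2 r (U p) w → RootOrDeg2 r (U′ j) w
        rootOrDeg2-U′ w (inj₁ w≡r)  = inj₁ w≡r
        rootOrDeg2-U′ w (inj₂ 2≤d) with w ≟ src e | E (U p) e in e∈?U
        ... | no w≢v   | _     = inj₂ (≤-trans 2≤d (deg-mono (U p) (U′ j)
          λ f∈ inc → U⊆U′ f∈ λ { refl → w≢v (loop-incident loop inc) }))
        ... | yes refl | false = inj₂ (≤-trans 2≤d (deg-mono (U p) (U′ j)
          λ f∈ _ → U⊆U′ f∈ λ { refl → not-¬ e∈?U f∈ }))
        ... | yes refl | true  = Sum.map₂ (λ 2≤d′ → ≤-trans 2≤d′ (deg-mono (U i) (U′ j)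
          λ f∈ _ → Ui⊆U′ (e∈U⇒i≺p e∈?U) f∈)) rd

        vertices-U′ : ∀ w → w ∈V U p → w ≡ r ⊎ w ∈V U′ j
        vertices-U′ w w∈ with ∈V-⋃⁻ (_≺ p) Gs w∈
        ... | q , q≺p , w∈Gq with punchInView i q
        ...   | punched q′ = inj₂ (∈V-⋃⁺ (_≺ j) Gs′ (trans (sym (punchIn-≺ i q′ j)) q≺p) w∈Gq)
        ...   | at with vertices-≡ w w∈Gq
        ...     | refl = Sum.map₂ src∈U′ rd
          where
          src∈U′ : 2 ≤ deg (U i) (src e) → src e ∈V U′ j
          src∈U′ 2≤d with deg≢0⇒incident (U i) (m<n⇒n≢0 2≤d)
          ... | f , f∈ , inc = ⋃-incident-∈V (_≺ j) Gs′ (Gs⊑ ∘ punchIn i) (Ui⊆U′ q≺p f∈) inc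

        canReplace : CanReplace (U p) (U′ j)
        canReplace = record { edges = U′⊆U ; rootOrDeg2 = rootOrDeg2-U′ ; vertices = vertices-U′ }

    module _ {G : Sub M} {m} {Gs : Fin (suc (suc m)) → Sub M} {i : Fin (suc (suc m))} {e : Fin k} where

      chainDecomposition-─loop : IsChainDecomposition r G Gs → e ∈E Gs i → IsLoop {M} e →
                                 IsChainDecomposition r (G ─ e) (Gs ∘ punchIn i)
      chainDecomposition-─loop (r∈G , Gs⊑ , cover , disjoint , chains) e∈Gi loop =
        r∈G , (λ j → ⊑-─ (Gs⊑ _) (e∉ j)) , cover′ ,
        (λ a b f fa fb → punchIn-injective i a b (disjoint _ _ f fa fb)) ,
        λ j → chain-replace (Delete.canReplace <-order ∉H rootOrDeg2-H j)
                            (Delete.canReplace >-order ∉Hb rootOrDeg2-Hb j) (chains (punchIn i j))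
        where
        open LoopChain (chain-loop {Before r Gs i} {After r Gs i} (chains i) e∈Gi loop)
        open IsLoopAt isLoopAt using (edges-≡)
        module Delete = DeleteLoopChain Gs Gs⊑ disjoint loop isLoopAt

        e∉ : ∀ j → ¬ (e ∈E Gs (punchIn i j))
        e∉ j e∈ = punchInᵢ≢i i j (disjoint _ _ e e∈ e∈Gi)

        cover′ : ∀ f → f ∈E (G ─ e) → ∃[ j ] f ∈E Gs (punchIn i j)
        cover′ f f∈ with ∈E-─⁻ {S = G} f∈
        ... | f∈G , f≢e with cover f f∈G
        ...   | q , f∈Gq with punchInView i q
        ...     | at        = ⊥-elim (f≢e (edges-≡ f f∈Gq))
        ...     | punched j = j , f∈Gq

      noIsolatedVertices-─loop : IsChainDecomposition r G Gs → e ∈E Gs i → IsLoop {M} e →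
                                 NoIsolatedVertices G → NoIsolatedVertices (G ─ e)
      noIsolatedVertices-─loop dec e∈Gi loop no-iso w w∈ with w ≟ src e
      ... | no w≢v with deg≢0⇒incident G (no-iso w w∈)
      ...   | f , f∈ , inc = incident⇒deg-─≢0 G f∈ (λ { refl → w≢v (loop-incident loop inc) }) inc
      noIsolatedVertices-─loop dec@(_ , Gs⊑ , _ , _ , chains) e∈Gi loop no-iso w w∈ | yes refl =
        [ at-root , through-Before ] rootOrDeg2-H
        where
        open LoopChain (chain-loop {Before r Gs i} {After r Gs i} (chains i) e∈Gi loop)

        at-root : src e ≡ r → deg (G ─ e) (src e) ≢ 0
        at-root v≡r =
          let f , f∈ , inc = root-incident (chainDecomposition-─loop dec e∈Gi loop)
          in incident⇒deg≢0 {S = G ─ e} f∈ (subst (Incident f) (sym v≡r) inc)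

        through-Before : 2 ≤ deg (Before r Gs i) (src e) → deg (G ─ e) (src e) ≢ 0
        through-Before 2≤d with deg≢0⇒incident (Before r Gs i) (m<n⇒n≢0 2≤d)
        ... | f , f∈ , inc =
          incident⇒deg-─≢0 G (∈E-⋃⇒∈E (λ q → toℕ q <ᵇ toℕ i) Gs {G} {f} Gs⊑ f∈)
            (λ { refl → ∉H f∈ }) inc

corollary7 : (M : Multigraph) (r : Fin (Multigraph.n M)) (m : ℕ)
    (Gs : Fin (suc (suc m)) → Sub M) →
    IsChainDecomposition r (whole {M}) Gs →
    (i : Fin (suc (suc m))) (e : Fin (Multigraph.k M)) →
    e ∈E Gs i → IsLoop {M} e →
    IsChainDecomposition r (whole ─ e) (λ j → Gs (punchIn i j))
    × (NoIsolatedVertices (whole {M}) → NoIsolatedVertices (whole {M} ─ e))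
corollary7 M r m Gs dec i e e∈Gi loop =
  chainDecomposition-─loop r dec e∈Gi loop , noIsolatedVertices-─loop r dec e∈Gi loop
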